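{- Let $G:\{0,1\}^s\to\{0,1\}^n$ and let $B$ be an ordered branching program of length $n$ with layers $V_0,\ldots,V_n$. Suppose that for every $i<n$, $\sum_{v\in V_i}|\mathbb{E}_G[N_v]|\le\varepsilon$. Then $G$ $\varepsilon\cdot n$-fools $B$, i.e., $|\mathbb{E}[B]-\mathbb{E}_G[B]|\le\varepsilon n$.
   Context: An ordered branching program (OBP) of length $n$ has layers $V_0,\ldots,V_n$, a single start state $v_0\in V_0$, two outgoing edges labeled $0$ and $1$ from each state of $V_i$ ($i<n$) into $V_{i+1}$, and labels in $\{0,1\}$ on $V_n$; $B[v,\sigma]$ denotes the state reached from $v$ by following the edges labeled by the bits of $\sigma$, and $B(x)$ is the label of $B[v_0,x]$. For $v\in V_i$, $B_{\to v}:\{0,1\}^i\to\{0,1\}$ is defined by $B_{\to v}(x)=1$ iff $B[v_0,x_{1..i}]=v$. For $i<n$ and $v\in V_i$, $N_v:\{0,1\}^{i+1}\to\{ -1,0,1\}$ is defined by $N_v(x)=1$ if $B_{\to v}(x_{1..i})=1$ and $x_{i+1}=1$; $N_v(x)=-1$ if $B_{\to v}(x_{1..i})=1$ and $x_{i+1}=0$; and $N_v(x)=0$ otherwise. For a function $h$ on $\{0,1\}^k$ with $k\le n$, $\mathbb{E}[h]$ is its expectation under a uniformly random input and $\mathbb{E}_G[h]=\mathbb{E}_{y\in\{0,1\}^s\text{ uniform}}[h(G(y)_{1..k})]$.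
   Formalization: The parameter ε is taken to be rational. -}

module Defs where

open import Data.Bool using (Bool; true; false; if_then_else_)
open import Data.Nat as ℕ using (ℕ; zero; suc; _^_; _<_; _≤_)
open import Data.Nat.Properties using (m^n≢0; <⇒≤; ≤-refl)
open import Data.Fin using (Fin; inject≤; _≟_)
open import Data.Fin.Base using ()
open import Data.Vec using (Vec; []; _∷_; init; last; tabulate; lookup)
open import Data.List using (List; []; _∷_; map; _++_; allFin)
open import Data.Integer using (+_; -[1+_])
open import Data.Rational using (ℚ; 0ℚ; 1ℚ; _+_; _*_; _/_; ∣_∣; _-_; _≤_)
open import Relation.Nullary using (yes; no)

-- An ordered branching program of length n.
-- Layer V_i is Fin (width i).  The transition function is given for
-- every layer index i (only i < n matters); start state v0 ∈ V_0;
-- labels on V_n.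
record OBP (n : ℕ) : Set where
  field
    width : ℕ → ℕ
    start : Fin (width 0)
    step  : (i : ℕ) → Fin (width i) → Bool → Fin (width (suc i))
    label : Fin (width n) → Bool
open OBP public

-- B[v0, x] for x ∈ {0,1}^k  (x_{1..k} read left to right)
reach : ∀ {n} (B : OBP n) (k : ℕ) → Vec Bool k → Fin (width B k)
reach B zero    []       = start B
reach B (suc k) x@(_ ∷ _) = step B k (reach B k (init x)) (last x)

evalB : ∀ {n} (B : OBP n) → Vec Bool n → ℚ
evalB {n} B x = if label B (reach B n x) then 1ℚ else 0ℚ

Nv : ∀ {n} (B : OBP n) (i : ℕ) (v : Fin (width B i)) → Vec Bool (suc i) → ℚ
Nv B i v x with reach B i (init x) ≟ v
... | yes _ = if last x then 1ℚ else (-[1+ 0 ] / 1)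
... | no  _ = 0ℚ

allVecs : (k : ℕ) → List (Vec Bool k)
allVecs zero    = [] ∷ []
allVecs (suc k) = map (false ∷_) (allVecs k) ++ map (true ∷_) (allVecs k)

sumℚ : List ℚ → ℚ
sumℚ []       = 0ℚ
sumℚ (q ∷ qs) = q + sumℚ qs

E : (k : ℕ) → (Vec Bool k → ℚ) → ℚ
E k h = sumℚ (map h (allVecs k)) * ((+ 1) / (2 ^ k)) {{m^n≢0 2 k}}

prefix : ∀ {n} (k : ℕ) → k ℕ.≤ n → Vec Bool n → Vec Bool k
prefix k k≤n x = tabulate (λ j → lookup x (inject≤ j k≤n))

EG : ∀ {s n} (G : Vec Bool s → Vec Bool n) (k : ℕ) → k ℕ.≤ n → (Vec Bool k → ℚ) → ℚ
EG {s} G k k≤n h = E s (λ y → h (prefix k k≤n (G y)))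

-- For 0 ≤ k ≤ n let H_k be the acceptance probability of B when its first k input bits are
-- the first k bits of G(y) and the remaining n − k bits are uniform; thus H_0 = E[B] and
-- H_n = E_G[B].  Averaging over the bit k+1 shows that H_k − H_{k+1} = Σ_v c_v E_G[N_v],
-- where c_v is half the difference of the acceptance probabilities from the two successors
-- of v, so |c_v| ≤ 1 and |H_k − H_{k+1}| ≤ ε.  Telescoping over k gives the bound ε n.
module Submission where

open import Defs
open import Data.Bool using (Bool; true; false; if_then_else_)
open import Data.Nat as ℕ using (ℕ; zero; suc; NonZero; _<_; _≤‴_; ≤‴-refl; ≤‴-step; z≤n)
open import Data.Nat.Properties using (≤-refl; <⇒≤; ≤⇒≤‴; ≤‴-irrelevant; m*n≢0; m^n≢0)
open import Data.Vec using (Vec; []; _∷_; _∷ʳ_; init; last; tabulate; lookup)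
import Data.Vec.Properties as Vecₚ
open import Data.Fin as Fin using (Fin; inject₁; inject≤)
import Data.Fin.Properties as Finₚ
open import Data.List as List using (List; map; allFin; _++_)
import Data.List.Properties as Listₚ
open import Data.Integer as ℤ using (+_; -[1+_])
import Data.Integer.Properties as ℤₚ
open import Data.Rational using (ℚ; 0ℚ; 1ℚ; ½; _+_; _*_; _-_; _/_; ∣_∣; _≤_; toℚᵘ; fromℚᵘ)
open import Data.Rational.Properties
  using ( toℚᵘ-injective; toℚᵘ-fromℚᵘ; toℚᵘ-homo-+; toℚᵘ-homo-*
        ; +-identityˡ; +-identityʳ; +-assoc; +-inverseʳ; *-identityˡ; *-assoc
        ; *-zeroˡ; *-zeroʳ; *-distribˡ-+; *-distribʳ-+
        ; ≤-reflexive; ≤-trans; +-mono-≤; *-monoˡ-≤-nonNeg; *-monoʳ-≤-nonNeg; nonNegative⁻¹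
        ; ∣p+q∣≤∣p∣+∣q∣; ∣p-q∣≤∣p∣+∣q∣; ∣p*q∣≡∣p∣*∣q∣; 0≤p⇒∣p∣≡p; ∣-∣-nonNeg
        ; module ≤-Reasoning )
import Data.Rational.Unnormalised as ℚᵘ
import Data.Rational.Unnormalised.Properties as ℚᵘₚ
open import Data.Rational.Solver using (module +-*-Solver)
open import Data.Product using (_×_; _,_; proj₁; proj₂)
open import Function using (_∘_; id)
open import Relation.Nullary using (yes; no; contradiction)
open import Relation.Binary.PropositionalEquality
  using (_≡_; _≢_; refl; sym; trans; cong; cong₂; module ≡-Reasoning)

open +-*-Solver

fromℚᵘ-homo-+ : ∀ p q → fromℚᵘ (p ℚᵘ.+ q) ≡ fromℚᵘ p + fromℚᵘ q
fromℚᵘ-homo-+ p q = toℚᵘ-injective (begin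
    toℚᵘ (fromℚᵘ (p ℚᵘ.+ q))               ≈⟨ toℚᵘ-fromℚᵘ (p ℚᵘ.+ q) ⟩
    p ℚᵘ.+ q                               ≈⟨ ℚᵘₚ.+-cong (toℚᵘ-fromℚᵘ p) (toℚᵘ-fromℚᵘ q) ⟨
    toℚᵘ (fromℚᵘ p) ℚᵘ.+ toℚᵘ (fromℚᵘ q)  ≈⟨ toℚᵘ-homo-+ (fromℚᵘ p) (fromℚᵘ q) ⟨
    toℚᵘ (fromℚᵘ p + fromℚᵘ q)             ∎)
  where open ℚᵘₚ.≃-Reasoning

fromℚᵘ-homo-* : ∀ p q → fromℚᵘ (p ℚᵘ.* q) ≡ fromℚᵘ p * fromℚᵘ q
fromℚᵘ-homo-* p q = toℚᵘ-injective (begin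
    toℚᵘ (fromℚᵘ (p ℚᵘ.* q))               ≈⟨ toℚᵘ-fromℚᵘ (p ℚᵘ.* q) ⟩
    p ℚᵘ.* q                               ≈⟨ ℚᵘₚ.*-cong (toℚᵘ-fromℚᵘ p) (toℚᵘ-fromℚᵘ q) ⟨
    toℚᵘ (fromℚᵘ p) ℚᵘ.* toℚᵘ (fromℚᵘ q)  ≈⟨ toℚᵘ-homo-* (fromℚᵘ p) (fromℚᵘ q) ⟨
    toℚᵘ (fromℚᵘ p * fromℚᵘ q)             ∎)
  where open ℚᵘₚ.≃-Reasoning

/1-homo-+ : ∀ i j → (i ℤ.+ j) / 1 ≡ i / 1 + j / 1
/1-homo-+ i j = begin
    (i ℤ.+ j) / 1
      ≡⟨ cong₂ (λ a b → (a ℤ.+ b) / 1) (ℤₚ.*-identityʳ i) (ℤₚ.*-identityʳ j) ⟨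
    fromℚᵘ (ℚᵘ.mkℚᵘ i 0 ℚᵘ.+ ℚᵘ.mkℚᵘ j 0)
      ≡⟨ fromℚᵘ-homo-+ (ℚᵘ.mkℚᵘ i 0) (ℚᵘ.mkℚᵘ j 0) ⟩
    i / 1 + j / 1 ∎
  where open ≡-Reasoning

1/[m*n] : ∀ m n .{{_ : NonZero m}} .{{_ : NonZero n}} →
          (+ 1 / (m ℕ.* n)) {{m*n≢0 m n}} ≡ (+ 1 / m) * (+ 1 / n)
1/[m*n] (suc m) (suc n) = fromℚᵘ-homo-* (ℚᵘ.mkℚᵘ (+ 1) m) (ℚᵘ.mkℚᵘ (+ 1) n)

∣p-r∣≤∣p-q∣+∣q-r∣ : ∀ p q r → ∣ p - r ∣ ≤ ∣ p - q ∣ + ∣ q - r ∣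
∣p-r∣≤∣p-q∣+∣q-r∣ p q r = begin
    ∣ p - r ∣                ≡⟨ cong ∣_∣ (solve 3 (λ p q r → p :- r := (p :- q) :+ (q :- r))
                                                refl p q r) ⟩
    ∣ (p - q) + (q - r) ∣    ≤⟨ ∣p+q∣≤∣p∣+∣q∣ (p - q) (q - r) ⟩
    ∣ p - q ∣ + ∣ q - r ∣    ∎
  where open ≤-Reasoning

∣½[p-q]∣≤1 : ∀ {p q} → 0ℚ ≤ p → p ≤ 1ℚ → 0ℚ ≤ q → q ≤ 1ℚ → ∣ ½ * (p - q) ∣ ≤ 1ℚ
∣½[p-q]∣≤1 {p} {q} 0≤p p≤1 0≤q q≤1 = begin
    ∣ ½ * (p - q) ∣      ≡⟨ ∣p*q∣≡∣p∣*∣q∣ ½ (p - q) ⟩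
    ½ * ∣ p - q ∣        ≤⟨ *-monoˡ-≤-nonNeg ½ (∣p-q∣≤∣p∣+∣q∣ p q) ⟩
    ½ * (∣ p ∣ + ∣ q ∣)  ≡⟨ cong₂ (λ a b → ½ * (a + b)) (0≤p⇒∣p∣≡p 0≤p) (0≤p⇒∣p∣≡p 0≤q) ⟩
    ½ * (p + q)          ≤⟨ *-monoˡ-≤-nonNeg ½ (+-mono-≤ p≤1 q≤1) ⟩
    ½ * (1ℚ + 1ℚ)        ≡⟨⟩
    1ℚ                   ∎
  where open ≤-Reasoning

telescope : ∀ {n} (a : ∀ k → k ℕ.≤ n → ℚ) {ε} →
            (∀ k (k<n : k < n) → ∣ a k (<⇒≤ k<n) - a (suc k) k<n ∣ ≤ ε) →
            ∣ a 0 z≤n - a n ≤-refl ∣ ≤ ε * (+ n / 1)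
telescope {n} a {ε} step = go n ≤-refl
  where
  go : ∀ m (m≤n : m ℕ.≤ n) → ∣ a 0 z≤n - a m m≤n ∣ ≤ ε * (+ m / 1)
  go zero    z≤n = ≤-reflexive (trans (cong ∣_∣ (+-inverseʳ (a 0 z≤n))) (sym (*-zeroʳ ε)))
  go (suc m) m<n = begin
    ∣ a 0 z≤n - a (suc m) m<n ∣
      ≤⟨ ∣p-r∣≤∣p-q∣+∣q-r∣ (a 0 z≤n) (a m (<⇒≤ m<n)) (a (suc m) m<n) ⟩
    ∣ a 0 z≤n - a m (<⇒≤ m<n) ∣ + ∣ a m (<⇒≤ m<n) - a (suc m) m<n ∣
      ≤⟨ +-mono-≤ (go m (<⇒≤ m<n)) (step m m<n) ⟩
    ε * (+ m / 1) + ε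
      ≡⟨ solve 2 (λ e x → e :* x :+ e := e :* (con 1ℚ :+ x)) refl ε (+ m / 1) ⟩
    ε * (1ℚ + + m / 1)
      ≡⟨ cong (ε *_) (/1-homo-+ (+ 1) (+ m)) ⟨
    ε * (+ suc m / 1) ∎
    where open ≤-Reasoning

sumℚ-++ : ∀ (xs ys : List ℚ) → sumℚ (xs ++ ys) ≡ sumℚ xs + sumℚ ys
sumℚ-++ List.[]       ys = sym (+-identityˡ (sumℚ ys))
sumℚ-++ (x List.∷ xs) ys =
  trans (cong (_+_ x) (sumℚ-++ xs ys)) (sym (+-assoc x (sumℚ xs) (sumℚ ys)))

module _ {A : Set} where

  sumℚ-map-cong : ∀ {f g : A → ℚ} → (∀ x → f x ≡ g x) → ∀ xs → sumℚ (map f xs) ≡ sumℚ (map g xs)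
  sumℚ-map-cong f≡g xs = cong sumℚ (Listₚ.map-cong f≡g xs)

  sumℚ-map-zero : ∀ {f : A → ℚ} → (∀ x → f x ≡ 0ℚ) → ∀ xs → sumℚ (map f xs) ≡ 0ℚ
  sumℚ-map-zero f≡0 List.[]       = refl
  sumℚ-map-zero f≡0 (x List.∷ xs) =
    trans (cong₂ _+_ (f≡0 x) (sumℚ-map-zero f≡0 xs)) (+-identityʳ 0ℚ)

  sumℚ-map-+ : ∀ (f g : A → ℚ) xs →
               sumℚ (map (λ x → f x + g x) xs) ≡ sumℚ (map f xs) + sumℚ (map g xs)
  sumℚ-map-+ f g List.[]       = refl
  sumℚ-map-+ f g (x List.∷ xs) = trans (cong (_+_ (f x + g x)) (sumℚ-map-+ f g xs))
    (solve 4 (λ a b c d → (a :+ b) :+ (c :+ d) := (a :+ c) :+ (b :+ d)) refl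
       (f x) (g x) (sumℚ (map f xs)) (sumℚ (map g xs)))

  sumℚ-map-difference : ∀ (f g : A → ℚ) xs →
                        sumℚ (map (λ x → f x - g x) xs) ≡ sumℚ (map f xs) - sumℚ (map g xs)
  sumℚ-map-difference f g List.[]       = refl
  sumℚ-map-difference f g (x List.∷ xs) =
    trans (cong (_+_ (f x - g x)) (sumℚ-map-difference f g xs))
    (solve 4 (λ a b c d → (a :- b) :+ (c :- d) := (a :+ c) :- (b :+ d)) refl
       (f x) (g x) (sumℚ (map f xs)) (sumℚ (map g xs)))

  sumℚ-map-*ˡ : ∀ c (f : A → ℚ) xs → sumℚ (map (λ x → c * f x) xs) ≡ c * sumℚ (map f xs)
  sumℚ-map-*ˡ c f List.[]       = sym (*-zeroʳ c)
  sumℚ-map-*ˡ c f (x List.∷ xs) = trans (cong (_+_ (c * f x)) (sumℚ-map-*ˡ c f xs))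
    (sym (*-distribˡ-+ c (f x) (sumℚ (map f xs))))

  sumℚ-map-*ʳ : ∀ c (f : A → ℚ) xs → sumℚ (map (λ x → f x * c) xs) ≡ sumℚ (map f xs) * c
  sumℚ-map-*ʳ c f List.[]       = sym (*-zeroˡ c)
  sumℚ-map-*ʳ c f (x List.∷ xs) = trans (cong (_+_ (f x * c)) (sumℚ-map-*ʳ c f xs))
    (sym (*-distribʳ-+ c (f x) (sumℚ (map f xs))))

  ∣sumℚ-map-*∣≤sumℚ-map-∣∣ : ∀ (c e : A → ℚ) → (∀ x → ∣ c x ∣ ≤ 1ℚ) → ∀ xs →
    ∣ sumℚ (map (λ x → c x * e x) xs) ∣ ≤ sumℚ (map (λ x → ∣ e x ∣) xs)
  ∣sumℚ-map-*∣≤sumℚ-map-∣∣ c e ∣c∣≤1 List.[]       = ≤-reflexive refl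
  ∣sumℚ-map-*∣≤sumℚ-map-∣∣ c e ∣c∣≤1 (x List.∷ xs) = begin
      ∣ c x * e x + sumℚ (map (λ x → c x * e x) xs) ∣
        ≤⟨ ∣p+q∣≤∣p∣+∣q∣ (c x * e x) _ ⟩
      ∣ c x * e x ∣ + ∣ sumℚ (map (λ x → c x * e x) xs) ∣
        ≤⟨ +-mono-≤ ∣cx*ex∣≤∣ex∣ (∣sumℚ-map-*∣≤sumℚ-map-∣∣ c e ∣c∣≤1 xs) ⟩
      ∣ e x ∣ + sumℚ (map (λ x → ∣ e x ∣) xs) ∎
    where
    open ≤-Reasoning
    ∣cx*ex∣≤∣ex∣ : ∣ c x * e x ∣ ≤ ∣ e x ∣
    ∣cx*ex∣≤∣ex∣ = begin
      ∣ c x * e x ∣      ≡⟨ ∣p*q∣≡∣p∣*∣q∣ (c x) (e x) ⟩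
      ∣ c x ∣ * ∣ e x ∣  ≤⟨ *-monoʳ-≤-nonNeg ∣ e x ∣ {{∣-∣-nonNeg (e x)}} (∣c∣≤1 x) ⟩
      1ℚ * ∣ e x ∣       ≡⟨ *-identityˡ ∣ e x ∣ ⟩
      ∣ e x ∣            ∎

sumℚ-map-swap : ∀ {A B : Set} (h : A → B → ℚ) xs ys →
  sumℚ (map (λ x → sumℚ (map (h x) ys)) xs) ≡ sumℚ (map (λ y → sumℚ (map (λ x → h x y) xs)) ys)
sumℚ-map-swap h List.[]       ys = sym (sumℚ-map-zero (λ _ → refl) ys)
sumℚ-map-swap h (x List.∷ xs) ys =
  trans (cong (_+_ (sumℚ (map (h x) ys))) (sumℚ-map-swap h xs ys))
        (sym (sumℚ-map-+ (h x) (λ y → sumℚ (map (λ x → h x y) xs)) ys))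

sumℚ-tabulate-single : ∀ {m} (u : Fin m) (f : Fin m → ℚ) → (∀ v → v ≢ u → f v ≡ 0ℚ) →
                       sumℚ (List.tabulate f) ≡ f u
sumℚ-tabulate-single {suc m} Fin.zero    f f≡0 = begin
    f Fin.zero + sumℚ (List.tabulate (f ∘ Fin.suc))  ≡⟨ cong (_+_ (f Fin.zero)) rest≡0 ⟩
    f Fin.zero + 0ℚ                                  ≡⟨ +-identityʳ (f Fin.zero) ⟩
    f Fin.zero                                       ∎
  where
  open ≡-Reasoning
  rest≡0 : sumℚ (List.tabulate (f ∘ Fin.suc)) ≡ 0ℚ
  rest≡0 = trans (cong sumℚ (sym (Listₚ.map-tabulate id (f ∘ Fin.suc))))
                 (sumℚ-map-zero (λ v → f≡0 (Fin.suc v) (λ ())) (allFin m))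
sumℚ-tabulate-single {suc m} (Fin.suc u) f f≡0 = begin
    f Fin.zero + rest  ≡⟨ cong (_+ rest) (f≡0 Fin.zero (λ ())) ⟩
    0ℚ + rest          ≡⟨ +-identityˡ rest ⟩
    rest               ≡⟨ sumℚ-tabulate-single u (f ∘ Fin.suc) f∘suc≡0 ⟩
    f (Fin.suc u)      ∎
  where
  open ≡-Reasoning
  rest = sumℚ (List.tabulate (f ∘ Fin.suc))
  f∘suc≡0 : ∀ v → v ≢ u → f (Fin.suc v) ≡ 0ℚ
  f∘suc≡0 v v≢u = f≡0 (Fin.suc v) (v≢u ∘ Finₚ.suc-injective)

sumℚ-allFin-single : ∀ {m} (u : Fin m) (f : Fin m → ℚ) → (∀ v → v ≢ u → f v ≡ 0ℚ) →
                     sumℚ (map f (allFin m)) ≡ f u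
sumℚ-allFin-single u f f≡0 =
  trans (cong sumℚ (Listₚ.map-tabulate id f)) (sumℚ-tabulate-single u f f≡0)

sumCube : (k : ℕ) → (Vec Bool k → ℚ) → ℚ
sumCube k f = sumℚ (map f (allVecs k))

1/2^ : ℕ → ℚ
1/2^ k = (+ 1 / 2 ℕ.^ k) {{m^n≢0 2 k}}

1/2^-suc : ∀ k → 1/2^ (suc k) ≡ ½ * 1/2^ k
1/2^-suc k = 1/[m*n] 2 (2 ℕ.^ k) {{_}} {{m^n≢0 2 k}}

sumCube-∷ : ∀ k f → sumCube (suc k) f ≡ sumCube k (f ∘ (false ∷_)) + sumCube k (f ∘ (true ∷_))
sumCube-∷ k f = begin
    sumℚ (map f (map (false ∷_) xs ++ map (true ∷_) xs))
      ≡⟨ cong sumℚ (Listₚ.map-++ f (map (false ∷_) xs) (map (true ∷_) xs)) ⟩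
    sumℚ (map f (map (false ∷_) xs) ++ map f (map (true ∷_) xs))
      ≡⟨ sumℚ-++ (map f (map (false ∷_) xs)) (map f (map (true ∷_) xs)) ⟩
    sumℚ (map f (map (false ∷_) xs)) + sumℚ (map f (map (true ∷_) xs))
      ≡⟨ cong₂ (λ a b → sumℚ a + sumℚ b) (Listₚ.map-∘ xs) (Listₚ.map-∘ xs) ⟨
    sumCube k (f ∘ (false ∷_)) + sumCube k (f ∘ (true ∷_)) ∎
  where
  open ≡-Reasoning
  xs = allVecs k

sumCube-∷ʳ : ∀ k f → sumCube (suc k) f ≡ sumCube k (λ x → f (x ∷ʳ false) + f (x ∷ʳ true))
sumCube-∷ʳ zero    f = solve 2 (λ a b → a :+ (b :+ con 0ℚ) := (a :+ b) :+ con 0ℚ) refl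
                         (f (false ∷ [])) (f (true ∷ []))
sumCube-∷ʳ (suc k) f = begin
    sumCube (suc (suc k)) f
      ≡⟨ sumCube-∷ (suc k) f ⟩
    sumCube (suc k) (f ∘ (false ∷_)) + sumCube (suc k) (f ∘ (true ∷_))
      ≡⟨ cong₂ _+_ (sumCube-∷ʳ k (f ∘ (false ∷_))) (sumCube-∷ʳ k (f ∘ (true ∷_))) ⟩
    sumCube k (g ∘ (false ∷_)) + sumCube k (g ∘ (true ∷_))
      ≡⟨ sumCube-∷ k g ⟨
    sumCube (suc k) g ∎
  where
  open ≡-Reasoning
  g = λ x → f (x ∷ʳ false) + f (x ∷ʳ true)

E-cong : ∀ k {f g : Vec Bool k → ℚ} → (∀ x → f x ≡ g x) → E k f ≡ E k g
E-cong k f≡g = cong (_* 1/2^ k) (sumℚ-map-cong f≡g (allVecs k))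

E-[] : ∀ f → E 0 f ≡ f []
E-[] f = solve 1 (λ a → (a :+ con 0ℚ) :* con 1ℚ := a) refl (f [])

E-∷ʳ : ∀ k f → E (suc k) f ≡ E k (λ x → ½ * (f (x ∷ʳ false) + f (x ∷ʳ true)))
E-∷ʳ k f = begin
    sumCube (suc k) f * 1/2^ (suc k)  ≡⟨ cong₂ _*_ (sumCube-∷ʳ k f) (1/2^-suc k) ⟩
    sumCube k g * (½ * 1/2^ k)        ≡⟨ solve 2 (λ s w → s :* (con ½ :* w) := (con ½ :* s) :* w)
                                                 refl (sumCube k g) (1/2^ k) ⟩
    (½ * sumCube k g) * 1/2^ k        ≡⟨ cong (_* 1/2^ k) (sumℚ-map-*ˡ ½ g (allVecs k)) ⟨
    E k (λ x → ½ * g x)               ∎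
  where
  open ≡-Reasoning
  g = λ x → f (x ∷ʳ false) + f (x ∷ʳ true)

E-const : ∀ k c → E k (λ _ → c) ≡ c
E-const zero    c = E-[] (λ _ → c)
E-const (suc k) c = begin
    E (suc k) (λ _ → c)        ≡⟨ E-∷ʳ k (λ _ → c) ⟩
    E k (λ _ → ½ * (c + c))    ≡⟨ E-cong k (λ _ → solve 1 (λ c → con ½ :* (c :+ c) := c) refl c) ⟩
    E k (λ _ → c)              ≡⟨ E-const k c ⟩
    c                          ∎
  where open ≡-Reasoning

E-difference : ∀ k f g → E k f - E k g ≡ E k (λ x → f x - g x)
E-difference k f g = begin
    sumCube k f * 1/2^ k - sumCube k g * 1/2^ k  ≡⟨ solve 3 (λ a b w → a :* w :- b :* w := (a :- b) :* w)
                                                      refl (sumCube k f) (sumCube k g) (1/2^ k) ⟩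
    (sumCube k f - sumCube k g) * 1/2^ k         ≡⟨ cong (_* 1/2^ k)
                                                      (sumℚ-map-difference f g (allVecs k)) ⟨
    E k (λ x → f x - g x)                        ∎
  where open ≡-Reasoning

E-linear : ∀ {A : Set} k (c : A → ℚ) (h : A → Vec Bool k → ℚ) vs →
           E k (λ x → sumℚ (map (λ v → c v * h v x) vs)) ≡ sumℚ (map (λ v → c v * E k (h v)) vs)
E-linear k c h vs = begin
    sumCube k (λ x → sumℚ (map (λ v → c v * h v x) vs)) * 1/2^ k
      ≡⟨ cong (_* 1/2^ k) (sumℚ-map-swap (λ x v → c v * h v x) (allVecs k) vs) ⟩
    sumℚ (map (λ v → sumCube k (λ x → c v * h v x)) vs) * 1/2^ k
      ≡⟨ sumℚ-map-*ʳ (1/2^ k) (λ v → sumCube k (λ x → c v * h v x)) vs ⟨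
    sumℚ (map (λ v → sumCube k (λ x → c v * h v x) * 1/2^ k) vs)
      ≡⟨ sumℚ-map-cong (λ v → cong (_* 1/2^ k) (sumℚ-map-*ˡ (c v) (h v) (allVecs k))) vs ⟩
    sumℚ (map (λ v → (c v * sumCube k (h v)) * 1/2^ k) vs)
      ≡⟨ sumℚ-map-cong (λ v → *-assoc (c v) (sumCube k (h v)) (1/2^ k)) vs ⟩
    sumℚ (map (λ v → c v * E k (h v)) vs) ∎
  where open ≡-Reasoning

init-tabulate : ∀ {A : Set} {k} (g : Fin (suc k) → A) → init (tabulate g) ≡ tabulate (g ∘ inject₁)
init-tabulate {k = zero}  g = refl
init-tabulate {k = suc k} g = cong (g Fin.zero ∷_) (init-tabulate (g ∘ Fin.suc))

init-prefix : ∀ {n k} (k<n : k < n) (x : Vec Bool n) →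
              init (prefix (suc k) k<n x) ≡ prefix k (<⇒≤ k<n) x
init-prefix {k = k} k<n x = trans (init-tabulate (λ j → lookup x (inject≤ j k<n)))
  (Vecₚ.tabulate-cong (λ j → cong (lookup x) (Finₚ.toℕ-injective (begin
    Fin.toℕ (inject≤ (inject₁ j) k<n)  ≡⟨ Finₚ.toℕ-inject≤ (inject₁ j) k<n ⟩
    Fin.toℕ (inject₁ j)                ≡⟨ Finₚ.toℕ-inject₁ j ⟩
    Fin.toℕ j                          ≡⟨ Finₚ.toℕ-inject≤ j (<⇒≤ k<n) ⟨
    Fin.toℕ (inject≤ j (<⇒≤ k<n))      ∎))))
  where open ≡-Reasoning

±1 : Bool → ℚ
±1 b = if b then 1ℚ else -[1+ 0 ] / 1

½[q0+q1]-q[b] : ∀ (q : Bool → ℚ) b → ½ * (q false + q true) - q b ≡ ½ * (q false - q true) * ±1 b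
½[q0+q1]-q[b] q true  = solve 2 (λ a b → con ½ :* (a :+ b) :- b := con ½ :* (a :- b) :* con 1ℚ)
                          refl (q false) (q true)
½[q0+q1]-q[b] q false = solve 2 (λ a b → con ½ :* (a :+ b) :- a
                                        := con ½ :* (a :- b) :* con (-[1+ 0 ] / 1))
                          refl (q false) (q true)

module _ {n : ℕ} (B : OBP n) where

  reach-∷ʳ : ∀ k (x : Vec Bool k) b → reach B (suc k) (x ∷ʳ b) ≡ step B k (reach B k x) b
  reach-∷ʳ zero    []       b = refl
  reach-∷ʳ (suc k) (y ∷ xs) b = cong₂ (λ u c → step B (suc k) (reach B (suc k) u) c)
                                      (Vecₚ.init-∷ʳ b (y ∷ xs)) (Vecₚ.last-∷ʳ b (y ∷ xs))

  Nv-reach : ∀ k (x : Vec Bool (suc k)) → Nv B k (reach B k (init x)) x ≡ ±1 (last x)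
  Nv-reach k x with reach B k (init x) Fin.≟ reach B k (init x)
  ... | yes _ = refl
  ... | no u≢u = contradiction refl u≢u

  Nv-≢ : ∀ k v (x : Vec Bool (suc k)) → v ≢ reach B k (init x) → Nv B k v x ≡ 0ℚ
  Nv-≢ k v x v≢u with reach B k (init x) Fin.≟ v
  ... | yes u≡v = contradiction (sym u≡v) v≢u
  ... | no _    = refl

  acceptProb : ∀ k → k ≤‴ n → Fin (width B k) → ℚ
  acceptProb k ≤‴-refl       v = if label B v then 1ℚ else 0ℚ
  acceptProb k (≤‴-step k<n) v =
    ½ * (acceptProb (suc k) k<n (step B k v false) + acceptProb (suc k) k<n (step B k v true))

  acceptProb-irrelevant : ∀ {k} (p q : k ≤‴ n) v → acceptProb k p v ≡ acceptProb k q v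
  acceptProb-irrelevant p q v = cong (λ r → acceptProb _ r v) (≤‴-irrelevant p q)

  0≤acceptProb≤1 : ∀ k (p : k ≤‴ n) v → 0ℚ ≤ acceptProb k p v × acceptProb k p v ≤ 1ℚ
  0≤acceptProb≤1 k ≤‴-refl v with label B v
  ... | true  = nonNegative⁻¹ 1ℚ , ≤-reflexive refl
  ... | false = ≤-reflexive refl , nonNegative⁻¹ 1ℚ
  0≤acceptProb≤1 k (≤‴-step k<n) v =
    *-monoˡ-≤-nonNeg ½ (+-mono-≤ (proj₁ b₀) (proj₁ b₁)) ,
    *-monoˡ-≤-nonNeg ½ (+-mono-≤ (proj₂ b₀) (proj₂ b₁))
    where
    b₀ = 0≤acceptProb≤1 (suc k) k<n (step B k v false)
    b₁ = 0≤acceptProb≤1 (suc k) k<n (step B k v true)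

  E-acceptProb-reach : ∀ k (p : k ≤‴ n) (q : 0 ≤‴ n) →
                       E k (λ x → acceptProb k p (reach B k x)) ≡ acceptProb 0 q (start B)
  E-acceptProb-reach zero    p q =
    trans (E-[] (λ x → acceptProb 0 p (reach B 0 x))) (acceptProb-irrelevant p q (start B))
  E-acceptProb-reach (suc k) p q = begin
      E (suc k) (λ x → acceptProb (suc k) p (reach B (suc k) x))
        ≡⟨ E-∷ʳ k _ ⟩
      E k (λ x → ½ * (acceptProb (suc k) p (reach B (suc k) (x ∷ʳ false))
                    + acceptProb (suc k) p (reach B (suc k) (x ∷ʳ true))))
        ≡⟨ E-cong k (λ x → cong₂ (λ a b → ½ * (acceptProb (suc k) p a + acceptProb (suc k) p b))
                             (reach-∷ʳ k x false) (reach-∷ʳ k x true)) ⟩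
      E k (λ x → acceptProb k (≤‴-step p) (reach B k x))
        ≡⟨ E-acceptProb-reach k (≤‴-step p) q ⟩
      acceptProb 0 q (start B) ∎
    where open ≡-Reasoning

  bitInfluence : ∀ k → suc k ≤‴ n → Fin (width B k) → ℚ
  bitInfluence k p v =
    ½ * (acceptProb (suc k) p (step B k v false) - acceptProb (suc k) p (step B k v true))

  ∣bitInfluence∣≤1 : ∀ k (p : suc k ≤‴ n) v → ∣ bitInfluence k p v ∣ ≤ 1ℚ
  ∣bitInfluence∣≤1 k p v = ∣½[p-q]∣≤1 (proj₁ b₀) (proj₂ b₀) (proj₁ b₁) (proj₂ b₁)
    where
    b₀ = 0≤acceptProb≤1 (suc k) p (step B k v false)
    b₁ = 0≤acceptProb≤1 (suc k) p (step B k v true)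

  acceptProb-difference : ∀ k (p : suc k ≤‴ n) (x : Vec Bool (suc k)) →
    acceptProb k (≤‴-step p) (reach B k (init x)) - acceptProb (suc k) p (reach B (suc k) x)
      ≡ sumℚ (map (λ v → bitInfluence k p v * Nv B k v x) (allFin (width B k)))
  acceptProb-difference k p x@(_ ∷ _) = begin
      ½ * (q false + q true) - q (last x)          ≡⟨ ½[q0+q1]-q[b] q (last x) ⟩
      bitInfluence k p u * ±1 (last x)             ≡⟨ cong (bitInfluence k p u *_) (Nv-reach k x) ⟨
      bitInfluence k p u * Nv B k u x              ≡⟨ sumℚ-allFin-single u _ off-u≡0 ⟨
      sumℚ (map (λ v → bitInfluence k p v * Nv B k v x) (allFin (width B k))) ∎
    where
    open ≡-Reasoning
    u = reach B k (init x)
    q = λ b → acceptProb (suc k) p (step B k u b)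
    off-u≡0 : ∀ v → v ≢ u → bitInfluence k p v * Nv B k v x ≡ 0ℚ
    off-u≡0 v v≢u =
      trans (cong (bitInfluence k p v *_) (Nv-≢ k v x v≢u)) (*-zeroʳ (bitInfluence k p v))

module _ {s n : ℕ} (G : Vec Bool s → Vec Bool n) (B : OBP n) where

  hybrid : ∀ k → k ℕ.≤ n → ℚ
  hybrid k k≤n = E s (λ y → acceptProb B k (≤⇒≤‴ k≤n) (reach B k (prefix k k≤n (G y))))

  hybrid-0 : hybrid 0 z≤n ≡ E n (evalB B)
  hybrid-0 = trans (E-const s (acceptProb B 0 (≤⇒≤‴ z≤n) (start B)))
                   (sym (E-acceptProb-reach B n ≤‴-refl (≤⇒≤‴ z≤n)))

  hybrid-n : hybrid n ≤-refl ≡ EG G n ≤-refl (evalB B)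
  hybrid-n = E-cong s (λ y → acceptProb-irrelevant B (≤⇒≤‴ ≤-refl) ≤‴-refl _)

  hybrid-difference : ∀ k (k<n : k < n) →
    hybrid k (<⇒≤ k<n) - hybrid (suc k) k<n
      ≡ sumℚ (map (λ v → bitInfluence B k (≤⇒≤‴ k<n) v * EG G (suc k) k<n (Nv B k v))
                  (allFin (width B k)))
  hybrid-difference k k<n = begin
      hybrid k (<⇒≤ k<n) - hybrid (suc k) k<n
        ≡⟨ E-difference s _ _ ⟩
      E s (λ y → acceptProb B k (≤⇒≤‴ (<⇒≤ k<n)) (reach B k (prefix k (<⇒≤ k<n) (G y)))
               - acceptProb B (suc k) p (reach B (suc k) (x y)))
        ≡⟨ E-cong s (λ y → cong (_- acceptProb B (suc k) p (reach B (suc k) (x y))) (via-init y)) ⟩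
      E s (λ y → acceptProb B k (≤‴-step p) (reach B k (init (x y)))
               - acceptProb B (suc k) p (reach B (suc k) (x y)))
        ≡⟨ E-cong s (λ y → acceptProb-difference B k p (x y)) ⟩
      E s (λ y → sumℚ (map (λ v → bitInfluence B k p v * Nv B k v (x y)) Vₖ))
        ≡⟨ E-linear s (bitInfluence B k p) (λ v y → Nv B k v (x y)) Vₖ ⟩
      sumℚ (map (λ v → bitInfluence B k p v * EG G (suc k) k<n (Nv B k v)) Vₖ) ∎
    where
    open ≡-Reasoning
    p = ≤⇒≤‴ k<n
    Vₖ = allFin (width B k)
    x = λ y → prefix (suc k) k<n (G y)
    via-init : ∀ y → acceptProb B k (≤⇒≤‴ (<⇒≤ k<n)) (reach B k (prefix k (<⇒≤ k<n) (G y)))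
                   ≡ acceptProb B k (≤‴-step p) (reach B k (init (x y)))
    via-init y = trans (acceptProb-irrelevant B (≤⇒≤‴ (<⇒≤ k<n)) (≤‴-step p) _)
                       (cong (acceptProb B k (≤‴-step p) ∘ reach B k) (sym (init-prefix k<n (G y))))

  ∣hybrid-difference∣≤ : ∀ k (k<n : k < n) →
    ∣ hybrid k (<⇒≤ k<n) - hybrid (suc k) k<n ∣
      ≤ sumℚ (map (λ v → ∣ EG G (suc k) k<n (Nv B k v) ∣) (allFin (width B k)))
  ∣hybrid-difference∣≤ k k<n = begin
      ∣ hybrid k (<⇒≤ k<n) - hybrid (suc k) k<n ∣
        ≡⟨ cong ∣_∣ (hybrid-difference k k<n) ⟩
      ∣ sumℚ (map (λ v → bitInfluence B k p v * EG G (suc k) k<n (Nv B k v)) Vₖ) ∣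
        ≤⟨ ∣sumℚ-map-*∣≤sumℚ-map-∣∣ (bitInfluence B k p) _ (∣bitInfluence∣≤1 B k p) Vₖ ⟩
      sumℚ (map (λ v → ∣ EG G (suc k) k<n (Nv B k v) ∣) Vₖ) ∎
    where
    open ≤-Reasoning
    p = ≤⇒≤‴ k<n
    Vₖ = allFin (width B k)

lemma3p4 : ∀ {s n : ℕ} (G : Vec Bool s → Vec Bool n) (B : OBP n) (ε : ℚ) →
    (∀ (i : ℕ) (i<n : i < n) →
      sumℚ (map (λ v → ∣ EG G (ℕ.suc i) i<n (Nv B i v) ∣) (allFin (width B i))) ≤ ε) →
    ∣ E n (evalB B) - EG G n ≤-refl (evalB B) ∣ ≤ ε * ((+ n) / 1)
lemma3p4 {n = n} G B ε hyp = begin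
    ∣ E n (evalB B) - EG G n ≤-refl (evalB B) ∣
      ≡⟨ cong₂ (λ a b → ∣ a - b ∣) (hybrid-0 G B) (hybrid-n G B) ⟨
    ∣ hybrid G B 0 z≤n - hybrid G B n ≤-refl ∣
      ≤⟨ telescope (hybrid G B) (λ k k<n → ≤-trans (∣hybrid-difference∣≤ G B k k<n) (hyp k k<n)) ⟩
    ε * (+ n / 1) ∎
  where open ≤-Reasoning
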